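{- $\partial \subset \lambda$ and $\partial^* \subset \lambda$, where both containments are strict.
   Context: Literals are propositions or their negations; ${\sim}q$ is the complement of $q$. A propositional defeasible theory is $D=(F,R,>)$: $F$ finite set of literals, $R$ finite set of rules, $>$ acyclic binary relation on $R$. Each rule has a finite antecedent set $A(r)$ and consequent literal and is strict ($\rightarrow$), defeasible ($\Rightarrow$) or a defeater ($\leadsto$). $R_s$: strict rules; $R_{sd}$: strict and defeasible rules; $R[q]$: rules with consequent $q$. A proof $P$ is a sequence of tagged literals, $P(1..i)$ its first $i$ elements; a conclusion is a consequence if it occurs in some proof. $+\Delta$: append $+\Delta q$ if $q\in F$ or some $r\in R_s[q]$ has $+\Delta a\in P(1..i)$ for all $a\in A(r)$. $-\Delta$: append $-\Delta q$ if $q\notin F$ and every $r\in R_s[q]$ has some $a\in A(r)$ with $-\Delta a\in P(1..i)$. $P_\Delta$: all $\pm\Delta$ conclusions derivable. $+\lambda$: append $+\lambda q$ if $+\Delta q\in P_\Delta$, or some $r\in R_{sd}[q]$ has $+\lambda a\in P(1..i)$ for all $a\in A(r)$ and $+\Delta{\sim}q\notin P_\Delta$. $+\partial$ (logic ${DL}(\partial)$): append $+\partial q$ if (1) $+\Delta q\in P(1..i)$, or (2.1) some $r\in R_{sd}[q]$ has $+\partial a\in P(1..i)$ for all $a\in A(r)$, (2.2) $-\Delta{\sim}q\in P(1..i)$, and (2.3) every $s\in R[{\sim}q]$ satisfies (2.3.1) some $a\in A(s)$ has $-\partial a\in P(1..i)$, or (2.3.2) some $t\in R_{sd}[q]$ with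 $t>s$ has $+\partial a\in P(1..i)$ for all $a\in A(t)$. $-\partial$: append $-\partial q$ if $-\Delta q\in P(1..i)$ and either every $r\in R_{sd}[q]$ has some $a\in A(r)$ with $-\partial a\in P(1..i)$, or $+\Delta{\sim}q\in P(1..i)$, or some $s\in R[{\sim}q]$ has $+\partial a\in P(1..i)$ for all $a\in A(s)$ and every $t\in R_{sd}[q]$ either has some $a\in A(t)$ with $-\partial a\in P(1..i)$ or not $t>s$. $\partial^*$ (individual defeat) is defined like $\partial$, with $\partial^*$ in place of $\partial$ throughout, except that in $+\partial^*$ condition (2.3.2) is replaced by $r>s$ (with $r$ the rule of (2.1)), and in $-\partial^*$ the last alternative requires that some $s\in R[{\sim}q]$ has $+\partial^* a\in P(1..i)$ for all $a\in A(s)$ and every $r\in R_{sd}[q]$ either has some $a\in A(r)$ with $-\partial^* a\in P(1..i)$ or not $r>s$. For tags $d_1,d_2$, $d_1\subseteq d_2$ means: for every propositional defeasible theory $T$ and literal $q$, if $+d_1 q$ is a consequence of $T$ then $+d_2 q$ is a consequence of $T$; $d_1\subset d_2$ means $d_1\subseteq d_2$ and some $T,q$ have $+d_2 q$ but not $+d_1 q$ as a consequence. -}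

module Defs where

open import Data.Nat using (ℕ)
open import Data.Fin using (Fin)
open import Data.List using (List; _∷_; [])
open import Data.List.Membership.Propositional using (_∈_; _∉_)
open import Data.List.Relation.Unary.All using (All)
open import Data.List.Relation.Unary.Any using (Any)
open import Data.Product using (Σ; ∃; _×_; _,_)
open import Data.Sum using (_⊎_)
open import Data.Empty using (⊥)
open import Relation.Nullary using (¬_)
open import Relation.Binary.PropositionalEquality using (_≡_; _≢_)
open import Relation.Binary.Construct.Closure.Transitive using (TransClosure)

data Lit : Set where
  pos : ℕ → Lit
  neg : ℕ → Lit

∼ : Lit → Lit
∼ (pos p) = neg p
∼ (neg p) = pos p

data Kind : Set where
  strict defeasible defeater : Kind

record Rule : Set where
  constructor rule
  field
    ant  : List Lit
    kind : Kind
    head : Lit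
open Rule public

record Theory : Set where
  field
    facts : List Lit
    n     : ℕ
    rules : Fin n → Rule
    sup   : List (Fin n × Fin n)
    acyclic : (i : Fin n) → ¬ TransClosure (λ a b → (a , b) ∈ sup) i i

data Tag : Set where
  +Δ -Δ +λ +∂ -∂ +∂* -∂* : Tag

TLit : Set
TLit = Tag × Lit

module _ (D : Theory) where
  open Theory D

  _≻_ : Fin n → Fin n → Set
  t ≻ s = (t , s) ∈ sup

  IsS : Fin n → Set
  IsS i = kind (rules i) ≡ strict

  IsSD : Fin n → Set
  IsSD i = kind (rules i) ≢ defeater

  Hd : Fin n → Lit → Set
  Hd i q = head (rules i) ≡ q

  AllT : Tag → List TLit → Fin n → Set
  AllT t P i = All (λ a → (t , a) ∈ P) (ant (rules i))

  AnyT : Tag → List TLit → Fin n → Set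
  AnyT t P i = Any (λ a → (t , a) ∈ P) (ant (rules i))

  -- Conditions for ±Δ; P is the prefix P(1..i).
  CondΔ : List TLit → TLit → Set
  CondΔ P (+Δ , q) = q ∈ facts ⊎ Σ (Fin n) λ r → IsS r × Hd r q × AllT +Δ P r
  CondΔ P (-Δ , q) = q ∉ facts × ((r : Fin n) → IsS r → Hd r q → AnyT -Δ P r)
  CondΔ P _ = ⊥

  -- Proofs using only ±Δ (list stored newest-first; the tail is the prefix)
  data ValidΔ : List TLit → Set where
    []  : ValidΔ []
    _∷_ : ∀ {P x} → CondΔ P x → ValidΔ P → ValidΔ (x ∷ P)

  PΔ : Tag → Lit → Set
  PΔ t q = Σ (List TLit) λ P → ValidΔ P × (t , q) ∈ P

  Cond : List TLit → TLit → Set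
  Cond P (+Δ , q) = CondΔ P (+Δ , q)
  Cond P (-Δ , q) = CondΔ P (-Δ , q)
  Cond P (+λ , q) =
    PΔ +Δ q ⊎
    (Σ (Fin n) λ r → IsSD r × Hd r q × AllT +λ P r × ¬ PΔ +Δ (∼ q))
  Cond P (+∂ , q) =
    (+Δ , q) ∈ P ⊎
    ((Σ (Fin n) λ r → IsSD r × Hd r q × AllT +∂ P r)
     × (-Δ , ∼ q) ∈ P
     × ((s : Fin n) → Hd s (∼ q) →
          AnyT -∂ P s ⊎
          (Σ (Fin n) λ t → IsSD t × Hd t q × t ≻ s × AllT +∂ P t)))
  Cond P (-∂ , q) =
    (-Δ , q) ∈ P ×
    (((r : Fin n) → IsSD r → Hd r q → AnyT -∂ P r)
     ⊎ (+Δ , ∼ q) ∈ P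
     ⊎ (Σ (Fin n) λ s → Hd s (∼ q) × AllT +∂ P s ×
          ((t : Fin n) → IsSD t → Hd t q → AnyT -∂ P t ⊎ ¬ (t ≻ s))))
  Cond P (+∂* , q) =
    (+Δ , q) ∈ P ⊎
    (Σ (Fin n) λ r → IsSD r × Hd r q × AllT +∂* P r
     × (-Δ , ∼ q) ∈ P
     × ((s : Fin n) → Hd s (∼ q) → AnyT -∂* P s ⊎ r ≻ s))
  Cond P (-∂* , q) =
    (-Δ , q) ∈ P ×
    (((r : Fin n) → IsSD r → Hd r q → AnyT -∂* P r)
     ⊎ (+Δ , ∼ q) ∈ P
     ⊎ (Σ (Fin n) λ s → Hd s (∼ q) × AllT +∂* P s ×
          ((r : Fin n) → IsSD r → Hd r q → AnyT -∂* P r ⊎ ¬ (r ≻ s))))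

  data Valid : List TLit → Set where
    []  : Valid []
    _∷_ : ∀ {P x} → Cond P x → Valid P → Valid (x ∷ P)

  Consequence : Tag → Lit → Set
  Consequence t q = Σ (List TLit) λ P → Valid P × (t , q) ∈ P

_⊆ᵀ_ : Tag → Tag → Set
d₁ ⊆ᵀ d₂ = (T : Theory) (q : Lit) → Consequence T d₁ q → Consequence T d₂ q

_⊂ᵀ_ : Tag → Tag → Set
d₁ ⊂ᵀ d₂ = d₁ ⊆ᵀ d₂ × Σ Theory λ T → Σ Lit λ q → Consequence T d₂ q × ¬ Consequence T d₁ q

module Submission where

-- Any ∂-proof (or ∂*-proof) P is translated line by line into
-- a proof Q in which every +∂ q and every +∂* q of P becomes +λ q.  The
-- translation of one line needs two facts about the definite part of P:
--   * the ±Δ lines of any proof form a Δ-proof on their own, so a line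
--     +Δ q of P shows +Δ q ∈ P_Δ (first clause of +λ);
--   * coherence of Δ: no literal is proved both +Δ and -Δ, so the line
--     -Δ ∼q required by clause (2.2) of +∂ / +∂* shows +Δ ∼q ∉ P_Δ.
-- The supporting rule r of +∂ q / +∂* q, whose antecedents are already
-- translated to +λ, then witnesses the second clause of +λ.
--
-- In the theory {⇒ p, ⇒ ¬p} without superiority, +λ p is
-- provable, but neither +∂ p nor +∂* p: nothing is definitely provable, and
-- the rule for ¬p has no antecedents to refute and no superior rule.

open import Defs
open import Data.Product using (_×_; Σ; _,_; proj₁)
open import Data.Fin using (Fin; zero; suc)
open import Data.List using (List; _∷_; [])
open import Data.List.Membership.Propositional using (_∈_)
open import Data.List.Relation.Unary.All as All using (_∷_; [])
open import Data.List.Relation.Unary.Any as Any using (here; there)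
open import Data.Sum using (inj₁; inj₂)
open import Data.Empty using (⊥; ⊥-elim)
open import Relation.Nullary using (¬_)
open import Relation.Binary.PropositionalEquality using (_≢_; refl; cong)
open import Relation.Binary.Construct.Closure.Transitive using (TransClosure; [_]; _∷_)

module _ (D : Theory) where

  Δproof⇒proof : ∀ {P} → ValidΔ D P → Valid D P
  Δproof⇒proof [] = []
  Δproof⇒proof (_∷_ {x = +Δ , _} c v) = c ∷ Δproof⇒proof v
  Δproof⇒proof (_∷_ {x = -Δ , _} c v) = c ∷ Δproof⇒proof v
  Δproof⇒proof (_∷_ {x = +λ , _} () v)
  Δproof⇒proof (_∷_ {x = +∂ , _} () v)
  Δproof⇒proof (_∷_ {x = -∂ , _} () v)
  Δproof⇒proof (_∷_ {x = +∂* , _} () v)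
  Δproof⇒proof (_∷_ {x = -∂* , _} () v)

  conditionOf : ∀ {P x} → Valid D P → x ∈ P →
                Σ (List TLit) λ P′ → Valid D P′ × Cond D P′ x
  conditionOf (c ∷ v) (here refl) = _ , v , c
  conditionOf (c ∷ v) (there m)   = conditionOf v m

  -- Induction on the proof of +Δ q: its strict rule has an antecedent a with
  -- +Δ a earlier, while the -Δ q line refutes the same rule through -Δ a.
  Δ-coherent : ∀ {P₁ P₂ q} → Valid D P₁ → Valid D P₂ →
               (+Δ , q) ∈ P₁ → (-Δ , q) ∈ P₂ → ⊥
  Δ-coherent (c ∷ v₁) v₂ (here refl) m₂ with conditionOf v₂ m₂ | c
  ... | _ , _   , (q∉F , _)     | inj₁ q∈F = q∉F q∈F
  ... | _ , v₂′ , (_ , refuted) | inj₂ (r , isS , hd , ants) =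
    let +a , -a = All.lookupAny ants (refuted r isS hd)
    in  Δ-coherent v₁ v₂′ +a -a
  Δ-coherent (_ ∷ v₁) v₂ (there m₁) m₂ = Δ-coherent v₁ v₂ m₁ m₂

  record ΔPart (P : List TLit) : Set where
    field
      lines   : List TLit
      isΔ     : ValidΔ D lines
      keeps+Δ : ∀ {x} → (+Δ , x) ∈ P → (+Δ , x) ∈ lines
      keeps-Δ : ∀ {x} → (-Δ , x) ∈ P → (-Δ , x) ∈ lines

  ΔPart-skip : ∀ {P t q} → +Δ ≢ t → -Δ ≢ t → ΔPart P → ΔPart ((t , q) ∷ P)
  ΔPart-skip +Δ≢t -Δ≢t Δ = record
    { lines   = lines
    ; isΔ     = isΔ
    ; keeps+Δ = λ { (here e) → ⊥-elim (+Δ≢t (cong proj₁ e)) ; (there m) → keeps+Δ m }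
    ; keeps-Δ = λ { (here e) → ⊥-elim (-Δ≢t (cong proj₁ e)) ; (there m) → keeps-Δ m }
    }
    where open ΔPart Δ

  -- The ±Δ lines of any proof form a Δ-proof: the ±Δ conditions only
  -- inspect ±Δ lines of the prefix.
  Δpart : ∀ {P} → Valid D P → ΔPart P
  Δpart [] = record { lines = [] ; isΔ = [] ; keeps+Δ = λ () ; keeps-Δ = λ () }
  Δpart (_∷_ {P = P} {x = +Δ , q} c v) = record
    { lines   = (+Δ , q) ∷ lines
    ; isΔ     = condition c ∷ isΔ
    ; keeps+Δ = λ { (here refl) → here refl ; (there m) → there (keeps+Δ m) }
    ; keeps-Δ = λ { (here ())              ; (there m) → there (keeps-Δ m) }
    }
    where
    open ΔPart (Δpart v)
    condition : CondΔ D P (+Δ , q) → CondΔ D lines (+Δ , q)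
    condition (inj₁ q∈F)                   = inj₁ q∈F
    condition (inj₂ (r , isS , hd , ants)) = inj₂ (r , isS , hd , All.map keeps+Δ ants)
  Δpart (_∷_ {x = -Δ , q} (q∉F , refuted) v) = record
    { lines   = (-Δ , q) ∷ lines
    ; isΔ     = (q∉F , λ r isS hd → Any.map keeps-Δ (refuted r isS hd)) ∷ isΔ
    ; keeps+Δ = λ { (here ())              ; (there m) → there (keeps+Δ m) }
    ; keeps-Δ = λ { (here refl) → here refl ; (there m) → there (keeps-Δ m) }
    }
    where open ΔPart (Δpart v)
  Δpart (_∷_ {x = +λ  , _} _ v) = ΔPart-skip (λ ()) (λ ()) (Δpart v)
  Δpart (_∷_ {x = +∂  , _} _ v) = ΔPart-skip (λ ()) (λ ()) (Δpart v)
  Δpart (_∷_ {x = -∂  , _} _ v) = ΔPart-skip (λ ()) (λ ()) (Δpart v)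
  Δpart (_∷_ {x = +∂* , _} _ v) = ΔPart-skip (λ ()) (λ ()) (Δpart v)
  Δpart (_∷_ {x = -∂* , _} _ v) = ΔPart-skip (λ ()) (λ ()) (Δpart v)

  +Δ∈PΔ : ∀ {P q} → Valid D P → (+Δ , q) ∈ P → PΔ D +Δ q
  +Δ∈PΔ v m = lines , isΔ , keeps+Δ m
    where open ΔPart (Δpart v)

  -Δ⇒+Δ∉PΔ : ∀ {P q} → Valid D P → (-Δ , q) ∈ P → ¬ PΔ D +Δ q
  -Δ⇒+Δ∉PΔ v m (R , isΔ , m′) = Δ-coherent (Δproof⇒proof isΔ) v m′ m

  record λTranslation (P : List TLit) : Set where
    field
      lines : List TLit
      valid : Valid D lines
      ∂⇒λ   : ∀ {x} → (+∂  , x) ∈ P → (+λ , x) ∈ lines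
      ∂*⇒λ  : ∀ {x} → (+∂* , x) ∈ P → (+λ , x) ∈ lines

  λTranslation-skip : ∀ {P t q} → +∂ ≢ t → +∂* ≢ t → λTranslation P → λTranslation ((t , q) ∷ P)
  λTranslation-skip +∂≢t +∂*≢t τ = record
    { lines = lines
    ; valid = valid
    ; ∂⇒λ   = λ { (here e) → ⊥-elim (+∂≢t (cong proj₁ e)) ; (there m) → ∂⇒λ m }
    ; ∂*⇒λ  = λ { (here e) → ⊥-elim (+∂*≢t (cong proj₁ e)) ; (there m) → ∂*⇒λ m }
    }
    where open λTranslation τ

  +∂⇒+λ : ∀ {P Q q} → Valid D P → (∀ {x} → (+∂ , x) ∈ P → (+λ , x) ∈ Q) →
          Cond D P (+∂ , q) → Cond D Q (+λ , q)
  +∂⇒+λ v _ (inj₁ +Δq) = inj₁ (+Δ∈PΔ v +Δq)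
  +∂⇒+λ v ∂⇒λ (inj₂ ((r , sd , hd , ants) , -Δ∼q , _)) =
    inj₂ (r , sd , hd , All.map ∂⇒λ ants , -Δ⇒+Δ∉PΔ v -Δ∼q)

  -- The same for +∂*: the team-defeat clause (2.3) is simply dropped.
  +∂*⇒+λ : ∀ {P Q q} → Valid D P → (∀ {x} → (+∂* , x) ∈ P → (+λ , x) ∈ Q) →
           Cond D P (+∂* , q) → Cond D Q (+λ , q)
  +∂*⇒+λ v _ (inj₁ +Δq) = inj₁ (+Δ∈PΔ v +Δq)
  +∂*⇒+λ v ∂*⇒λ (inj₂ (r , sd , hd , ants , -Δ∼q , _)) =
    inj₂ (r , sd , hd , All.map ∂*⇒λ ants , -Δ⇒+Δ∉PΔ v -Δ∼q)

  translate : ∀ {P} → Valid D P → λTranslation P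
  translate [] = record { lines = [] ; valid = [] ; ∂⇒λ = λ () ; ∂*⇒λ = λ () }
  translate (_∷_ {x = +∂ , q} c v) = record
    { lines = (+λ , q) ∷ lines
    ; valid = +∂⇒+λ v ∂⇒λ c ∷ valid
    ; ∂⇒λ   = λ { (here refl) → here refl ; (there m) → there (∂⇒λ m) }
    ; ∂*⇒λ  = λ { (here ())              ; (there m) → there (∂*⇒λ m) }
    }
    where open λTranslation (translate v)
  translate (_∷_ {x = +∂* , q} c v) = record
    { lines = (+λ , q) ∷ lines
    ; valid = +∂*⇒+λ v ∂*⇒λ c ∷ valid
    ; ∂⇒λ   = λ { (here ())              ; (there m) → there (∂⇒λ m) }
    ; ∂*⇒λ  = λ { (here refl) → here refl ; (there m) → there (∂*⇒λ m) }
    }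
    where open λTranslation (translate v)
  translate (_∷_ {x = +Δ , _} _ v) = λTranslation-skip (λ ()) (λ ()) (translate v)
  translate (_∷_ {x = -Δ , _} _ v) = λTranslation-skip (λ ()) (λ ()) (translate v)
  translate (_∷_ {x = +λ , _} _ v) = λTranslation-skip (λ ()) (λ ()) (translate v)
  translate (_∷_ {x = -∂ , _} _ v) = λTranslation-skip (λ ()) (λ ()) (translate v)
  translate (_∷_ {x = -∂* , _} _ v) = λTranslation-skip (λ ()) (λ ()) (translate v)

∂⊆λ : +∂ ⊆ᵀ +λ
∂⊆λ T q (P , v , m) = lines , valid , ∂⇒λ m
  where open λTranslation (translate T v)

∂*⊆λ : +∂* ⊆ᵀ +λ
∂*⊆λ T q (P , v , m) = lines , valid , ∂*⇒λ m
  where open λTranslation (translate T v)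

p : Lit
p = pos 0

conflicting : Fin 2 → Rule
conflicting zero       = rule [] defeasible p
conflicting (suc zero) = rule [] defeasible (∼ p)

Conflict : Theory
Conflict = record { facts = [] ; n = 2 ; rules = conflicting ; sup = [] ; acyclic = noCycle }
  where
  noCycle : (i : Fin 2) → ¬ TransClosure (λ a b → (a , b) ∈ []) i i
  noCycle i [ () ]
  noCycle i (() ∷ _)

-- Without facts or strict rules nothing is definitely provable.
no+Δ : ∀ {P x} → Valid Conflict P → ¬ (+Δ , x) ∈ P
no+Δ (inj₁ () ∷ _)                      (here refl)
no+Δ (inj₂ (zero , () , _) ∷ _)         (here refl)
no+Δ (inj₂ (suc zero , () , _) ∷ _)     (here refl)
no+Δ (_ ∷ v)                            (there m) = no+Δ v m

+λp : Consequence Conflict +λ p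
+λp = (+λ , p) ∷ [] , inj₂ (zero , (λ ()) , refl , [] , no+Δ∼p) ∷ [] , here refl
  where
  no+Δ∼p : ¬ PΔ Conflict +Δ (∼ p)
  no+Δ∼p (_ , isΔ , m) = no+Δ (Δproof⇒proof Conflict isΔ) m

-- +∂ p fails: the rule ⇒ ¬p has no antecedent to refute and no rule beats it.
no+∂p : ¬ Consequence Conflict +∂ p
no+∂p (P , v , m) = absent v m
  where
  absent : ∀ {P} → Valid Conflict P → ¬ (+∂ , p) ∈ P
  absent (inj₁ +Δp ∷ v) (here refl) = no+Δ v +Δp
  absent (inj₂ (_ , _ , attacks) ∷ _) (here refl) with attacks (suc zero) refl
  ... | inj₁ ()
  ... | inj₂ (_ , _ , _ , () , _)
  absent (_ ∷ v) (there m) = absent v m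

no+∂*p : ¬ Consequence Conflict +∂* p
no+∂*p (P , v , m) = absent v m
  where
  absent : ∀ {P} → Valid Conflict P → ¬ (+∂* , p) ∈ P
  absent (inj₁ +Δp ∷ v) (here refl) = no+Δ v +Δp
  absent (inj₂ (_ , _ , _ , _ , _ , attacks) ∷ _) (here refl) with attacks (suc zero) refl
  ... | inj₁ ()
  ... | inj₂ ()
  absent (_ ∷ v) (there m) = absent v m

propositionA3 : (+∂ ⊂ᵀ +λ) × (+∂* ⊂ᵀ +λ)
propositionA3 = (∂⊆λ  , Conflict , p , +λp , no+∂p)
              , (∂*⊆λ , Conflict , p , +λp , no+∂*p)
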